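{- Let $k\ge 1$, $n=2^k$, $d=n/2$, and partition $[d]$ into the sets $S_i=\{1\le j\le d: \gcd(n,j)=2^{k-i}\}$ for $i=1,\dots,k$. Let $\phi$ be a permutation of $[d]$ and let $t^{\phi}$ be its BLG edge-length vector. Then for each $i$, at most one $j\in S_i$ has $t^{\phi}_j>0$. Specifically, if $i_1,i_2\in S_i$ with $\phi^{ -1}(i_2)>\phi^{ -1}(i_1)$, then $t^{\phi}_{i_2}=0$ (i.e., the corresponding minimum-cost Hamiltonian path uses no edges of length $i_2$).
   Context: Vertices $[n]=\{1,\dots,n\}$ of the complete graph $K_n$; the length of edge $\{i,j\}$ is $\min\{|i-j|,n-|i-j|\}\in\{1,\dots,d\}$, $d=\lfloor n/2\rfloor$. For a permutation $\phi$ of $[d]$ (thought of as ordering the edge lengths by strictly increasing cost, $c_{\phi(1)}<\dots<c_{\phi(d)}$, where all edges of length $i$ cost $c_i$), the $g$-sequence is $g_0^{\phi}=n$, $g_i^{\phi}=\gcd(\phi(i),g_{i-1}^{\phi})$ for $1\le i\le d$. The BLG edge-length vector of $\phi$ is $t^{\phi}\in\mathbb{Z}_{\ge0}^d$ with $t^{\phi}_{\phi(i)}=g_{i-1}^{\phi}-g_i^{\phi}$ for $i=1,\dots,d$; it is the edge-length vector (number of edges of each length) of the minimum-cost Hamiltonian path of $K_n$ for such costs (a BLG path). -}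

module Defs where

open import Data.Nat using (ℕ; zero; suc; _∸_; _<_; _<?_)
open import Data.Nat.GCD using (gcd)
open import Data.Fin using (Fin; toℕ; fromℕ<)
open import Data.Fin.Permutation using (Permutation′; _⟨$⟩ʳ_; _⟨$⟩ˡ_)
open import Relation.Nullary using (yes; no)

-- Convention: an element j : Fin d stands for the edge length (toℕ j + 1) ∈ [d] = {1,…,d}.
len : {d : ℕ} → Fin d → ℕ
len j = suc (toℕ j)

-- Positions are 0-indexed: position p : ℕ (p < d) corresponds to the paper's index i = p + 1.
-- lengthAt φ p = φ(p+1) as an edge length (the value for p ≥ d is never used).
lengthAt : {d : ℕ} → Permutation′ d → ℕ → ℕ
lengthAt {d} φ p with p <? d
... | yes p<d = len (φ ⟨$⟩ʳ fromℕ< p<d)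
... | no _ = 0

gSeq : {d : ℕ} → ℕ → Permutation′ d → ℕ → ℕ
gSeq n φ zero = n
gSeq n φ (suc i) = gcd (lengthAt φ i) (gSeq n φ i)

-- BLG edge-length vector: t^φ_{φ(i)} = g_{i-1} - g_i.  For length j, i = φ⁻¹(j)
-- (paper index), i.e. 0-indexed position p = toℕ (φ ⟨$⟩ˡ j), so t_j = g_p - g_{p+1}.
blg : {d : ℕ} → ℕ → Permutation′ d → Fin d → ℕ
blg n φ j = gSeq n φ (toℕ (φ ⟨$⟩ˡ j)) ∸ gSeq n φ (suc (toℕ (φ ⟨$⟩ˡ j)))

{-# OPTIONS --safe #-}
module Submission where

open import Defs
open import Data.Nat using (ℕ; zero; suc; _∸_; _<_; _≤_; _^_; _<?_; _≤′_; ≤′-refl; ≤′-step)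
open import Data.Nat.GCD using (gcd; gcd[m,n]∣m; gcd[m,n]∣n; gcd-greatest)
open import Data.Nat.Divisibility using (_∣_; ∣-trans; ∣-antisym; ∣-refl; ∣-reflexive)
open import Data.Nat.Properties using (n∸n≡0; <-cmp; <-irrefl; ≤⇒≤′)
open import Data.Fin using (Fin; toℕ)
open import Data.Fin.Properties using (toℕ-injective; toℕ<n; fromℕ<-toℕ)
open import Data.Fin.Permutation using (Permutation′; _⟨$⟩ʳ_; _⟨$⟩ˡ_; inverseʳ; flip)
open import Function.Bundles using (Injection)
open import Function.Properties.Inverse using (↔⇒↣)
open import Data.Product using (_×_; _,_)
open import Data.Empty using (⊥-elim)
open import Relation.Binary using (tri<; tri≈; tri>)
open import Relation.Binary.PropositionalEquality using (_≡_; sym; trans; cong; subst)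
open import Relation.Nullary using (yes; no)

-- Each g_p divides n, and g_{p+1} divides the length processed at step p; the g-sequence
-- only shrinks in the divisibility order.  So once a length j₁ has been processed the
-- current g divides gcd(n, j₁).  If a later length j₂ has gcd(n, j₂) = gcd(n, j₁), then
-- the current g already divides j₂, the gcd does not drop at j₂'s step, and t_{j₂} = 0.
-- Nothing about n = 2^k is needed: the classes S_i are just level sets of gcd(n, ·).

module _ {d : ℕ} (n : ℕ) (φ : Permutation′ d) where

  position : Fin d → ℕ
  position j = toℕ (φ ⟨$⟩ˡ j)

  gSeq-suc-∣ : ∀ p → gSeq n φ (suc p) ∣ gSeq n φ p
  gSeq-suc-∣ p = gcd[m,n]∣n (lengthAt φ p) (gSeq n φ p)

  gSeq-∣-n : ∀ p → gSeq n φ p ∣ n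
  gSeq-∣-n zero    = ∣-refl
  gSeq-∣-n (suc p) = ∣-trans (gSeq-suc-∣ p) (gSeq-∣-n p)

  gSeq-antitone′ : ∀ {p q} → p ≤′ q → gSeq n φ q ∣ gSeq n φ p
  gSeq-antitone′ ≤′-refl           = ∣-refl
  gSeq-antitone′ (≤′-step {q} p≤q) = ∣-trans (gSeq-suc-∣ q) (gSeq-antitone′ p≤q)

  gSeq-antitone : ∀ {p q} → p ≤ q → gSeq n φ q ∣ gSeq n φ p
  gSeq-antitone p≤q = gSeq-antitone′ (≤⇒≤′ p≤q)

  lengthAt-position : ∀ j → lengthAt φ (position j) ≡ len j
  lengthAt-position j with position j <? d
  ... | yes p<d = cong len (trans (cong (φ ⟨$⟩ʳ_) (fromℕ<-toℕ (φ ⟨$⟩ˡ j) p<d)) (inverseʳ φ))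
  ... | no p≮d  = ⊥-elim (p≮d (toℕ<n (φ ⟨$⟩ˡ j)))

  gSeq-after : ∀ j → gSeq n φ (suc (position j)) ≡ gcd (len j) (gSeq n φ (position j))
  gSeq-after j = cong (λ l → gcd l (gSeq n φ (position j))) (lengthAt-position j)

  gSeq-after-∣-gcd : ∀ j → gSeq n φ (suc (position j)) ∣ gcd n (len j)
  gSeq-after-∣-gcd j = subst (_∣ gcd n (len j)) (sym (gSeq-after j))
    (gcd-greatest (∣-trans (gcd[m,n]∣n (len j) g) (gSeq-∣-n (position j))) (gcd[m,n]∣m (len j) g))
    where g = gSeq n φ (position j)

  blg≡0-if-gSeq-∣-len : ∀ j → gSeq n φ (position j) ∣ len j → blg n φ j ≡ 0
  blg≡0-if-gSeq-∣-len j g∣j = trans (cong (g ∸_) g′≡g) (n∸n≡0 g)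
    where
    g = gSeq n φ (position j)
    g′≡g : gSeq n φ (suc (position j)) ≡ g
    g′≡g = trans (gSeq-after j) (∣-antisym (gcd[m,n]∣n (len j) g) (gcd-greatest g∣j ∣-refl))

  blg-later≡0 : ∀ {j₁ j₂} → gcd n (len j₁) ≡ gcd n (len j₂) →
                position j₁ < position j₂ → blg n φ j₂ ≡ 0
  blg-later≡0 {j₁} {j₂} same p₁<p₂ = blg≡0-if-gSeq-∣-len j₂
    (∣-trans (gSeq-antitone p₁<p₂)
      (∣-trans (gSeq-after-∣-gcd j₁) (∣-trans (∣-reflexive same) (gcd[m,n]∣n n (len j₂)))))

  position-injective : ∀ {j₁ j₂} → position j₁ ≡ position j₂ → j₁ ≡ j₂
  position-injective eq = Injection.injective (↔⇒↣ (flip φ)) (toℕ-injective eq)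

  positive-blg-unique : ∀ {j₁ j₂} → gcd n (len j₁) ≡ gcd n (len j₂) →
                        0 < blg n φ j₁ → 0 < blg n φ j₂ → j₁ ≡ j₂
  positive-blg-unique {j₁} {j₂} same t₁>0 t₂>0 with <-cmp (position j₁) (position j₂)
  ... | tri< p₁<p₂ _ _ = ⊥-elim (<-irrefl (sym (blg-later≡0 same p₁<p₂)) t₂>0)
  ... | tri≈ _ p₁≡p₂ _ = position-injective p₁≡p₂
  ... | tri> _ _ p₂<p₁ = ⊥-elim (<-irrefl (sym (blg-later≡0 (sym same) p₂<p₁)) t₁>0)

mainTheorem5 : (m : ℕ) (φ : Permutation′ (2 ^ m)) (i : ℕ) → 1 ≤ i → i ≤ suc m →
    ((j₁ j₂ : Fin (2 ^ m)) →
      gcd (2 ^ suc m) (len j₁) ≡ 2 ^ (suc m ∸ i) →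
      gcd (2 ^ suc m) (len j₂) ≡ 2 ^ (suc m ∸ i) →
      0 < blg (2 ^ suc m) φ j₁ → 0 < blg (2 ^ suc m) φ j₂ → j₁ ≡ j₂)
    ×
    ((j₁ j₂ : Fin (2 ^ m)) →
      gcd (2 ^ suc m) (len j₁) ≡ 2 ^ (suc m ∸ i) →
      gcd (2 ^ suc m) (len j₂) ≡ 2 ^ (suc m ∸ i) →
      toℕ (φ ⟨$⟩ˡ j₁) < toℕ (φ ⟨$⟩ˡ j₂) →
      blg (2 ^ suc m) φ j₂ ≡ 0)
mainTheorem5 m φ i _ _ =
    (λ _ _ e₁ e₂ → positive-blg-unique n φ (trans e₁ (sym e₂)))
  , (λ _ _ e₁ e₂ → blg-later≡0 n φ (trans e₁ (sym e₂)))
  where n = 2 ^ suc m
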